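{- For all $n,k,j\ge 1$ there is a bijection from the set of ordered trees with $n$ edges, $j$ internal nodes, and height at most $k$ onto the set of permutations $\sigma\in S_n(231)$ with $\mathrm{des}(\sigma)=j-1$ and $\mathrm{maxdrop}(\sigma)\le k-1$. Consequently, for $n\ge 1$ and $j,k\ge 0$, the number of $\sigma\in S_n(231)$ with $\mathrm{des}(\sigma)=j$ and $\mathrm{maxdrop}(\sigma)\le k$ equals the number of ordered trees with $n$ edges, $j+1$ internal nodes, and height at most $k+1$.
   Context: For a permutation $\sigma=\sigma_1\cdots\sigma_n$ of $[n]$, $\mathrm{des}(\sigma)$ is the number of $i\in[n-1]$ with $\sigma_i>\sigma_{i+1}$, and $\mathrm{maxdrop}(\sigma)=\max\{i-\sigma_i : i\in[n]\}$. $S_n(231)$ is the set of permutations of $[n]$ with no indices $a<b<c$ such that $\sigma_c<\sigma_a<\sigma_b$. An ordered tree is a rooted tree in which the children of each vertex are linearly ordered. The level of a vertex is its distance to the root; the height of the tree is the maximum level of a vertex. An internal node is a vertex with at least one child. -}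

module Defs where

open import Data.Nat using (ℕ; zero; suc; _+_; _∸_; _⊔_; _<?_)
open import Data.Fin using (Fin; toℕ; _<_)
open import Data.List using (List; []; _∷_; map; foldr; allFin)
open import Data.Product using (Σ; ∃; _×_; _,_)
open import Relation.Nullary using (¬_; yes; no)
open import Relation.Binary.PropositionalEquality using (_≡_)
open import Data.Fin.Permutation using (Permutation′; _⟨$⟩ʳ_)

data Tree : Set where
  node : List Tree → Tree

mutual
  edges : Tree → ℕ
  edges (node ts) = edgesF ts

  edgesF : List Tree → ℕ
  edgesF []       = 0
  edgesF (t ∷ ts) = suc (edges t) + edgesF ts

mutual
  internals : Tree → ℕ
  internals (node [])         = 0
  internals (node (t ∷ ts))   = suc (internalsF (t ∷ ts))

  internalsF : List Tree → ℕ
  internalsF []       = 0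
  internalsF (t ∷ ts) = internals t + internalsF ts

mutual
  height : Tree → ℕ
  height (node [])       = 0
  height (node (t ∷ ts)) = suc (heightF (t ∷ ts))

  heightF : List Tree → ℕ
  heightF []       = 0
  heightF (t ∷ ts) = height t ⊔ heightF ts

-- Permutations of [n] (positions and values indexed 0..n-1 via Fin n;
-- shifting both by 1 changes neither descents, pattern avoidance nor i - σ_i).

word : ∀ {n} → Permutation′ n → List ℕ
word {n} σ = map (λ i → toℕ (σ ⟨$⟩ʳ i)) (allFin n)

desFrom : ℕ → List ℕ → ℕ
desFrom x []      = 0
desFrom x (y ∷ r) with y <? x
... | yes _ = suc (desFrom y r)
... | no  _ = desFrom y r

desL : List ℕ → ℕ
desL []      = 0
desL (x ∷ r) = desFrom x r

des : ∀ {n} → Permutation′ n → ℕ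
des σ = desL (word σ)

-- maxdrop σ = max { i - σ_i }.  This maximum is always ≥ 0 (some i has σ_i ≤ i),
-- so computing it with truncated subtraction and base value 0 is exact.
maxdrop : ∀ {n} → Permutation′ n → ℕ
maxdrop {n} σ = foldr _⊔_ 0 (map (λ i → toℕ i ∸ toℕ (σ ⟨$⟩ʳ i)) (allFin n))

Avoids231 : ∀ {n} → Permutation′ n → Set
Avoids231 {n} σ =
  ¬ (Σ (Fin n) λ a → Σ (Fin n) λ b → Σ (Fin n) λ c →
       a < b × b < c × (σ ⟨$⟩ʳ c) < (σ ⟨$⟩ʳ a) × (σ ⟨$⟩ʳ a) < (σ ⟨$⟩ʳ b))

TreeSet : ℕ → ℕ → ℕ → Set
TreeSet n j k = Σ Tree λ t → edges t ≡ n × internals t ≡ j × Data.Nat._≤_ (height t) k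

PermSet : ℕ → ℕ → ℕ → Set
PermSet n d m = Σ (Permutation′ n) λ σ → Avoids231 σ × des σ ≡ d × Data.Nat._≤_ (maxdrop σ) m

_≈T_ : ∀ {n j k} → TreeSet n j k → TreeSet n j k → Set
(s , _) ≈T (t , _) = s ≡ t

_≈P_ : ∀ {n d m} → PermSet n d m → PermSet n d m → Set
_≈P_ {n} (σ , _) (τ , _) = ∀ (i : Fin n) → σ ⟨$⟩ʳ i ≡ τ ⟨$⟩ʳ i

IsBijection : {A B : Set} → (A → A → Set) → (B → B → Set) → (A → B) → Set
IsBijection {A} {B} _≈A_ _≈B_ f =
  (∀ x y → x ≈A y → f x ≈B f y) ×
  (∀ x y → f x ≈B f y → x ≈A y) ×
  (∀ y → Σ A λ x → f x ≈B y)

HasCard : {A : Set} → (A → A → Set) → ℕ → Set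
HasCard {A} _≈A_ m = Σ (A → Fin m) λ f → IsBijection _≈A_ _≡_ f

module Submission where

-- A tree is its root forest, and forests are encoded by gluing: for a forest whose first tree
-- has subforest G and whose other trees form F (with a and b edges), the permutation is the
-- word of F (values [0, a)), then the new maximum a + b, then the word of G shifted up by a.
-- Positions and values are naturals, a permutation of [0, n) being a pair of mutually inverse
-- functions ℕ → ℕ on [0, n) (IsPermutation).  We first show that gluing preserves permutations
-- and 231-avoidance, can be undone, and how it acts on descents and drops.  By induction the
-- encoding of a forest is an injective map into 231-avoiding permutations, turning internal
-- nodes into descents (each maximum followed by a nonempty block is one) and height into
-- maxdrop (the drop i - σ(i) grows by one per level).  Conversely, a 231-avoiding permutation
-- splits at its maximum into a permutation of the smaller values followed by one of the
-- larger values (MaxSplit), so by strong induction every such permutation is an encoding.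
-- Finally the construction is transported to Fin n, and the counting statement follows because
-- bijections preserve cardinalities.

open import Data.Empty using (⊥; ⊥-elim)
open import Data.Fin using (Fin; toℕ; fromℕ<) renaming (zero to fzero; suc to fsuc)
import Data.Fin.Properties as FinProps
open import Data.Fin.Permutation using (Permutation′; permutation; _⟨$⟩ʳ_; _⟨$⟩ˡ_; inverseˡ; inverseʳ)
open import Data.List using (List; []; _∷_; _++_; map; foldr; applyUpTo; tabulate)
open import Data.List.Properties using (map-applyUpTo; map-tabulate)
open import Data.List.Relation.Unary.All using (All; []; _∷_)
open import Data.List.Relation.Unary.All.Properties using (applyUpTo⁺₁)
open import Data.Nat using (ℕ; zero; suc; _+_; _∸_; _⊔_; _<_; _≤_; _≥_; _≮_; _<?_; z≤n; s≤s; s≤s⁻¹; s<s⁻¹)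
open import Data.Nat.Induction using (<-rec)
open import Data.Nat.Properties
open import Data.Nat.Tactic.RingSolver using (solve-∀)
open import Data.Product using (Σ; ∃; _×_; _,_; proj₁; proj₂)
open import Function using (_∘_)
open import Function.Bundles using (_⇔_; mk⇔)
import Function.Properties.Equivalence as ⇔
open import Relation.Binary using (IsEquivalence; tri<; tri≈; tri>)
open import Relation.Binary.PropositionalEquality
open import Relation.Nullary using (yes; no; contradiction)
open ≡-Reasoning

open import Defs

Bounded : (ℕ → ℕ) → ℕ → Set
Bounded f n = ∀ {i} → i < n → f i < n

Agree : ℕ → (ℕ → ℕ) → (ℕ → ℕ) → Set
Agree n f g = ∀ {i} → i < n → f i ≡ g i

record IsPermutation (n : ℕ) (g h : ℕ → ℕ) : Set where
  field
    bounded       : Bounded g n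
    inv-bounded   : Bounded h n
    left-inverse  : ∀ {i} → i < n → h (g i) ≡ i
    right-inverse : ∀ {v} → v < n → g (h v) ≡ v

Avoid231 : (ℕ → ℕ) → ℕ → Set
Avoid231 g n = ∀ x y z → x < y → y < z → z < n → g z < g x → g x < g y → ⊥

data Position (a i : ℕ) : Set where
  before : i < a → Position a i
  at     : i ≡ a → Position a i
  after  : (j : ℕ) → i ≡ suc (a + j) → Position a i

after≮ : ∀ a j → suc (a + j) ≮ a
after≮ a j lt = m+n≮m a j (<-trans (n<1+n (a + j)) lt)

after-of : ∀ {a i} → a < i → ∃ λ j → i ≡ suc (a + j)
after-of {a} {i} a<i = i ∸ suc a , sym (m+[n∸m]≡n a<i)

position : ∀ a i → Position a i
position a i with <-cmp i a
... | tri< i<a _ _ = before i<a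
... | tri≈ _ i≡a _ = at i≡a
... | tri> _ _ a<i = let j , e = after-of a<i in after j e

data ValuePosition (a b v : ℕ) : Set where
  below  : v < a → ValuePosition a b v
  inside : (w : ℕ) → w < b → v ≡ a + w → ValuePosition a b v
  top    : a + b ≤ v → ValuePosition a b v

valuePosition : ∀ a b v → ValuePosition a b v
valuePosition a b v with v <? a
... | yes v<a = below v<a
... | no v≮a with v ∸ a <? b
...   | yes w<b = inside (v ∸ a) w<b (sym (m+[n∸m]≡n (≮⇒≥ v≮a)))
...   | no w≮b  = top (subst (a + b ≤_) (m+[n∸m]≡n (≮⇒≥ v≮a)) (+-monoʳ-≤ a (≮⇒≥ w≮b)))

-- Gluing: the word  f(0) ⋯ f(a-1)  (a+b)  (a+g(0)) ⋯ (a+g(b-1))  of length 1+b+a,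
-- i.e. f, then a new maximum, then g shifted above f.
glue : ℕ → ℕ → (ℕ → ℕ) → (ℕ → ℕ) → ℕ → ℕ
glue a b f g i with position a i
... | before _  = f i
... | at _      = a + b
... | after j _ = a + g j

module Glued (a b : ℕ) (f g : ℕ → ℕ) where
  glue-before : ∀ {i} → i < a → glue a b f g i ≡ f i
  glue-before {i} i<a with position a i
  ... | before _     = refl
  ... | at refl      = contradiction i<a (n≮n a)
  ... | after j refl = contradiction i<a (after≮ a j)

  glue-at : glue a b f g a ≡ a + b
  glue-at with position a a
  ... | before a<a = contradiction a<a (n≮n a)
  ... | at _       = refl
  ... | after j e  = contradiction e (m≢1+m+n a)

  glue-after : ∀ j → glue a b f g (suc (a + j)) ≡ a + g j
  glue-after j with position a (suc (a + j))
  ... | before lt = contradiction lt (after≮ a j)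
  ... | at e      = contradiction (sym e) (m≢1+m+n a)
  ... | after k e = cong (λ x → a + g x) (+-cancelˡ-≡ a k j (sym (suc-injective e)))

unglue : ℕ → ℕ → (ℕ → ℕ) → (ℕ → ℕ) → ℕ → ℕ
unglue a b f′ g′ v with valuePosition a b v
... | below _      = f′ v
... | inside w _ _ = suc (a + g′ w)
... | top _        = a

module Unglued (a b : ℕ) (f′ g′ : ℕ → ℕ) where
  unglue-below : ∀ {v} → v < a → unglue a b f′ g′ v ≡ f′ v
  unglue-below {v} v<a with valuePosition a b v
  ... | below _         = refl
  ... | inside w _ refl = contradiction v<a (m+n≮m a w)
  ... | top a+b≤v       = contradiction v<a (≤⇒≯ (≤-trans (m≤m+n a b) a+b≤v))

  unglue-inside : ∀ {w} → w < b → unglue a b f′ g′ (a + w) ≡ suc (a + g′ w)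
  unglue-inside {w} w<b with valuePosition a b (a + w)
  ... | below lt      = contradiction lt (m+n≮m a w)
  ... | inside w′ _ e = cong (λ x → suc (a + g′ x)) (+-cancelˡ-≡ a w′ w (sym e))
  ... | top a+b≤a+w   = contradiction w<b (≤⇒≯ (+-cancelˡ-≤ a b w a+b≤a+w))

  unglue-top : unglue a b f′ g′ (a + b) ≡ a
  unglue-top with valuePosition a b (a + b)
  ... | below lt       = contradiction lt (m+n≮m a b)
  ... | inside w w<b e = contradiction w<b (≤⇒≯ (≤-reflexive (+-cancelˡ-≡ a b w e)))
  ... | top _          = refl

module GlueSize (a b : ℕ) where
  below-size : ∀ {x} → x < a → x < suc (b + a)
  below-size x<a = <-≤-trans x<a (≤-trans (m≤n+m a b) (n≤1+n (b + a)))

  at-size : a < suc (b + a)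
  at-size = s≤s (m≤n+m a b)

  top-size : a + b < suc (b + a)
  top-size = s≤s (≤-reflexive (+-comm a b))

  inside-size : ∀ {w} → w < b → a + w < suc (b + a)
  inside-size w<b = m<n⇒m<1+n (<-≤-trans (+-monoʳ-< a w<b) (≤-reflexive (+-comm a b)))

  after-size : ∀ {j} → j < b → suc (a + j) < suc (b + a)
  after-size j<b = s≤s (<-≤-trans (+-monoʳ-< a j<b) (≤-reflexive (+-comm a b)))

  after-size⁻¹ : ∀ {j} → suc (a + j) < suc (b + a) → j < b
  after-size⁻¹ {j} lt = +-cancelˡ-< a j b (subst (a + j <_) (+-comm b a) (s<s⁻¹ lt))

  ≤-top : ∀ {v} → v < suc (b + a) → v ≤ a + b
  ≤-top v<n = ≤-trans (s≤s⁻¹ v<n) (≤-reflexive (+-comm b a))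

module _ {a b : ℕ} {f g : ℕ → ℕ} where
  open GlueSize a b
  open Glued a b f g

  glue-bounded : Bounded f a → Bounded g b → Bounded (glue a b f g) (suc (b + a))
  glue-bounded fB gB {i} i<n with position a i
  ... | before i<a   = below-size (fB i<a)
  ... | at refl      = top-size
  ... | after j refl = inside-size (gB (after-size⁻¹ i<n))

  glue-≥ : ∀ {i} → a ≤ i → a ≤ glue a b f g i
  glue-≥ {i} a≤i with position a i
  ... | before i<a   = contradiction i<a (≤⇒≯ a≤i)
  ... | at refl      = m≤m+n a b
  ... | after j refl = m≤m+n a (g j)

  glue-max-unique : Bounded f a → Bounded g b → ∀ {i} → i < suc (b + a) →
                    glue a b f g i ≡ a + b → i ≡ a
  glue-max-unique fB gB {i} i<n e with position a i
  ... | before i<a   = contradiction (subst (_< a) e (fB i<a)) (m+n≮m a b)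
  ... | at refl      = refl
  ... | after j refl = contradiction (gB (after-size⁻¹ i<n)) (≤⇒≯ (≤-reflexive (+-cancelˡ-≡ a b (g j) (sym e))))

  glue-characterisation : ∀ G → Agree a G f → G a ≡ a + b →
                          (∀ {j} → j < b → G (suc (a + j)) ≡ a + g j) →
                          Agree (suc (b + a)) (glue a b f g) G
  glue-characterisation G lower middle upper {i} i<n with position a i
  ... | before i<a   = sym (lower i<a)
  ... | at refl      = sym middle
  ... | after j refl = sym (upper (after-size⁻¹ i<n))

  -- Gluing two 231-avoiding words around a new maximum avoids 231.  An occurrence x<y<z
  -- cannot end right of the left block while starting in it (its last letter would exceed
  -- its first), nor start at the maximum, so it lies inside one block.
  glue-avoids : Bounded f a → Bounded g b → Avoid231 f a → Avoid231 g b →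
                Avoid231 (glue a b f g) (suc (b + a))
  glue-avoids fB gB avoidsf avoidsg x y z x<y y<z z<n gz<gx gx<gy with z <? a
  ... | yes z<a =
    avoidsf x y z x<y y<z z<a (subst₂ _<_ (glue-before z<a) (glue-before x<a) gz<gx)
                              (subst₂ _<_ (glue-before x<a) (glue-before y<a) gx<gy)
    where
    y<a = <-trans y<z z<a
    x<a = <-trans x<y y<a
  ... | no z≮a with position a x
  ...   | before x<a =
    contradiction (<-trans gz<gx (fB x<a)) (≤⇒≯ (glue-≥ (≮⇒≥ z≮a)))
  ...   | at refl =
    contradiction gx<gy (≤⇒≯ (≤-top (glue-bounded fB gB (<-trans y<z z<n))))
  ...   | after i refl with after-of (<-trans (s≤s (m≤m+n a i)) x<y)
  ...     | j , refl with after-of (<-trans (<-trans (s≤s (m≤m+n a i)) x<y) y<z)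
  ...       | k , refl =
    avoidsg i j k (cancel x<y) (cancel y<z) (after-size⁻¹ z<n)
      (+-cancelˡ-< a _ _ (subst (_< a + g i) (glue-after k) gz<gx))
      (+-cancelˡ-< a _ _ (subst (a + g i <_) (glue-after j) gx<gy))
    where
    cancel : ∀ {u v} → suc (a + u) < suc (a + v) → u < v
    cancel lt = +-cancelˡ-< a _ _ (s<s⁻¹ lt)

glue-isPermutation : ∀ {a b f f′ g g′} → IsPermutation a f f′ → IsPermutation b g g′ →
                     IsPermutation (suc (b + a)) (glue a b f g) (unglue a b f′ g′)
glue-isPermutation {a} {b} {f} {f′} {g} {g′} F G = record
  { bounded = bounded ; inv-bounded = inv-bounded
  ; left-inverse = left-inverse ; right-inverse = right-inverse }
  where
  module F = IsPermutation F
  module G = IsPermutation G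
  open GlueSize a b
  open Glued a b f g
  open Unglued a b f′ g′

  bounded : Bounded (glue a b f g) (suc (b + a))
  bounded = glue-bounded F.bounded G.bounded

  inv-bounded : Bounded (unglue a b f′ g′) (suc (b + a))
  inv-bounded {v} v<n with valuePosition a b v
  ... | below v<a         = below-size (F.inv-bounded v<a)
  ... | inside w w<b refl = after-size (G.inv-bounded w<b)
  ... | top _             = at-size

  left-inverse : ∀ {i} → i < suc (b + a) → unglue a b f′ g′ (glue a b f g i) ≡ i
  left-inverse {i} i<n with position a i
  ... | before i<a   = trans (unglue-below (F.bounded i<a)) (F.left-inverse i<a)
  ... | at refl      = unglue-top
  ... | after j refl = let j<b = after-size⁻¹ i<n in
    trans (unglue-inside (G.bounded j<b)) (cong (λ x → suc (a + x)) (G.left-inverse j<b))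

  right-inverse : ∀ {v} → v < suc (b + a) → glue a b f g (unglue a b f′ g′ v) ≡ v
  right-inverse {v} v<n with valuePosition a b v
  ... | below v<a         = trans (glue-before (F.inv-bounded v<a)) (F.right-inverse v<a)
  ... | inside w w<b refl = trans (glue-after (g′ w)) (cong (a +_) (G.right-inverse w<b))
  ... | top a+b≤v         = trans glue-at (≤-antisym a+b≤v (≤-top v<n))

glue-injective : ∀ {a b f g a′ b′ f′ g′} → Bounded f a → Bounded g b → Bounded f′ a′ → Bounded g′ b′ →
                 b + a ≡ b′ + a′ → Agree (suc (b + a)) (glue a b f g) (glue a′ b′ f′ g′) →
                 a ≡ a′ × b ≡ b′ × Agree a f f′ × Agree b g g′
glue-injective {a} {b} {f} {g} {a′} {b′} {f′} {g′} fB gB fB′ gB′ size agree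
  with glue-max-unique fB′ gB′ (subst (a <_) (cong suc size) (GlueSize.at-size a b))
         (begin
           glue a′ b′ f′ g′ a ≡⟨ sym (agree (GlueSize.at-size a b)) ⟩
           glue a b f g a     ≡⟨ Glued.glue-at a b f g ⟩
           a + b              ≡⟨ +-comm a b ⟩
           b + a              ≡⟨ size ⟩
           b′ + a′            ≡⟨ +-comm b′ a′ ⟩
           a′ + b′            ∎)
... | refl with +-cancelʳ-≡ a b b′ size
...   | refl = refl , refl , lower , upper
  where
  open Glued a b
  open GlueSize a b
  lower : Agree a f f′
  lower i<a = trans (sym (glue-before f g i<a)) (trans (agree (below-size i<a)) (glue-before f′ g′ i<a))
  upper : Agree b g g′
  upper {j} j<b = +-cancelˡ-≡ a (g j) (g′ j)
    (trans (sym (glue-after f g j)) (trans (agree (after-size j<b)) (glue-after f′ g′ j)))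

applyUpTo-++ : ∀ {A : Set} (f : ℕ → A) m n →
               applyUpTo f (m + n) ≡ applyUpTo f m ++ applyUpTo (λ i → f (m + i)) n
applyUpTo-++ f zero    n = refl
applyUpTo-++ f (suc m) n = cong (f 0 ∷_) (applyUpTo-++ (f ∘ suc) m n)

applyUpTo-cong : ∀ {A : Set} {f g : ℕ → A} n → (∀ {i} → i < n → f i ≡ g i) →
                 applyUpTo f n ≡ applyUpTo g n
applyUpTo-cong zero    eq = refl
applyUpTo-cong (suc n) eq = cong₂ _∷_ (eq (s≤s z≤n)) (applyUpTo-cong n (eq ∘ s≤s))

tabulate-applyUpTo : ∀ {A : Set} n {k : Fin n → A} {f : ℕ → A} → (∀ i → k i ≡ f (toℕ i)) →
                     tabulate k ≡ applyUpTo f n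
tabulate-applyUpTo zero    eq = refl
tabulate-applyUpTo (suc n) eq = cong₂ _∷_ (eq fzero) (tabulate-applyUpTo n (eq ∘ fsuc))

glue-layout : ∀ a b f g (φ : ℕ → ℕ → ℕ) →
  applyUpTo (λ i → φ i (glue a b f g i)) (suc (b + a)) ≡
  applyUpTo (λ i → φ i (f i)) a ++ φ a (a + b) ∷ applyUpTo (λ j → φ (suc (a + j)) (a + g j)) b
glue-layout a b f g φ = begin
  applyUpTo w (suc (b + a))
    ≡⟨ cong (applyUpTo w) (trans (cong suc (+-comm b a)) (sym (+-suc a b))) ⟩
  applyUpTo w (a + suc b)
    ≡⟨ applyUpTo-++ w a (suc b) ⟩
  applyUpTo w a ++ w (a + 0) ∷ applyUpTo (λ j → w (a + suc j)) b
    ≡⟨ cong₂ _++_ lower (cong₂ _∷_ middle upper) ⟩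
  applyUpTo (λ i → φ i (f i)) a ++ φ a (a + b) ∷ applyUpTo (λ j → φ (suc (a + j)) (a + g j)) b ∎
  where
  open Glued a b f g
  w : ℕ → ℕ
  w i = φ i (glue a b f g i)
  lower : applyUpTo w a ≡ applyUpTo (λ i → φ i (f i)) a
  lower = applyUpTo-cong a (λ i<a → cong (φ _) (glue-before i<a))
  middle : w (a + 0) ≡ φ a (a + b)
  middle = trans (cong w (+-identityʳ a)) (cong (φ a) glue-at)
  upper : applyUpTo (λ j → w (a + suc j)) b ≡ applyUpTo (λ j → φ (suc (a + j)) (a + g j)) b
  upper = applyUpTo-cong b (λ {j} _ → trans (cong w (+-suc a j)) (cong (φ _) (glue-after j)))

desFrom-++ : ∀ x y A C → All (_< x) (y ∷ A) → desFrom y (A ++ x ∷ C) ≡ desFrom y A + desFrom x C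
desFrom-++ x y []      C (y<x ∷ []) with x <? y
... | yes x<y = contradiction x<y (<-asym y<x)
... | no _    = refl
desFrom-++ x y (z ∷ A) C (_ ∷ z<x∷A) with z <? y
... | yes _ = cong suc (desFrom-++ x z A C z<x∷A)
... | no _  = desFrom-++ x z A C z<x∷A

desL-++ : ∀ x A C → All (_< x) A → desL (A ++ x ∷ C) ≡ desL A + desFrom x C
desL-++ x []      C _     = refl
desL-++ x (y ∷ A) C A<x   = desFrom-++ x y A C A<x

desFrom-shift : ∀ c x C → desFrom (c + x) (map (c +_) C) ≡ desFrom x C
desFrom-shift c x []      = refl
desFrom-shift c x (y ∷ C) with c + y <? c + x | y <? x
... | yes _   | yes _   = cong suc (desFrom-shift c y C)
... | no _    | no _    = desFrom-shift c y C
... | yes lt  | no y≮x  = contradiction (+-cancelˡ-< c y x lt) y≮x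
... | no ≮    | yes y<x = contradiction (+-monoʳ-< c y<x) ≮

glue-descents : ∀ a b f g → Bounded f a →
  desL (applyUpTo (glue a b f g) (suc (b + a))) ≡
  desL (applyUpTo f a) + desFrom (a + b) (applyUpTo (λ j → a + g j) b)
glue-descents a b f g fB = begin
  desL (applyUpTo (glue a b f g) (suc (b + a)))
    ≡⟨ cong desL (glue-layout a b f g (λ _ v → v)) ⟩
  desL (applyUpTo f a ++ (a + b) ∷ applyUpTo (λ j → a + g j) b)
    ≡⟨ desL-++ (a + b) (applyUpTo f a) _ (applyUpTo⁺₁ f a (λ i<a → <-≤-trans (fB i<a) (m≤m+n a b))) ⟩
  desL (applyUpTo f a) + desFrom (a + b) (applyUpTo (λ j → a + g j) b) ∎

desFrom-block : ∀ a b g → Bounded g (suc b) →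
  desFrom (a + suc b) (applyUpTo (λ j → a + g j) (suc b)) ≡ suc (desL (applyUpTo g (suc b)))
desFrom-block a b g gB with a + g 0 <? a + suc b
... | no ≮ = contradiction (+-monoʳ-< a (gB (s≤s z≤n))) ≮
... | yes _ = cong suc (begin
  desFrom (a + g 0) (applyUpTo (λ j → a + g (suc j)) b)
    ≡⟨ cong (desFrom (a + g 0)) (sym (map-applyUpTo (g ∘ suc) (a +_) b)) ⟩
  desFrom (a + g 0) (map (a +_) (applyUpTo (g ∘ suc) b))
    ≡⟨ desFrom-shift a (g 0) (applyUpTo (g ∘ suc) b) ⟩
  desFrom (g 0) (applyUpTo (g ∘ suc) b) ∎)

maxL : List ℕ → ℕ
maxL = foldr _⊔_ 0

maxL-++ : ∀ A B → maxL (A ++ B) ≡ maxL A ⊔ maxL B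
maxL-++ []      B = refl
maxL-++ (x ∷ A) B = trans (cong (x ⊔_) (maxL-++ A B)) (sym (⊔-assoc x (maxL A) (maxL B)))

maxDrop : ℕ → (ℕ → ℕ) → ℕ → ℕ
maxDrop c f n = maxL (applyUpTo (λ i → (c + i) ∸ f i) n)

-- the maximum of a glued word drops by c - b; the right block sits one position further right
glue-maxDrop : ∀ c a b f g →
  maxDrop c (glue a b f g) (suc (b + a)) ≡ maxDrop c f a ⊔ ((c ∸ b) ⊔ maxDrop (suc c) g b)
glue-maxDrop c a b f g = begin
  maxDrop c (glue a b f g) (suc (b + a))
    ≡⟨ cong maxL (glue-layout a b f g (λ i v → (c + i) ∸ v)) ⟩
  maxL (applyUpTo (λ i → (c + i) ∸ f i) a ++ ((c + a) ∸ (a + b)) ∷ right)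
    ≡⟨ maxL-++ (applyUpTo (λ i → (c + i) ∸ f i) a) _ ⟩
  maxDrop c f a ⊔ (((c + a) ∸ (a + b)) ⊔ maxL right)
    ≡⟨ cong (maxDrop c f a ⊔_) (cong₂ _⊔_ middle (cong maxL upper)) ⟩
  maxDrop c f a ⊔ ((c ∸ b) ⊔ maxDrop (suc c) g b) ∎
  where
  right : List ℕ
  right = applyUpTo (λ j → (c + suc (a + j)) ∸ (a + g j)) b
  shift : ∀ c a j → c + suc (a + j) ≡ a + suc (c + j)
  shift = solve-∀
  middle : (c + a) ∸ (a + b) ≡ c ∸ b
  middle = trans (cong (_∸ (a + b)) (+-comm c a)) ([m+n]∸[m+o]≡n∸o a c b)
  upper : right ≡ applyUpTo (λ j → (suc c + j) ∸ g j) b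
  upper = applyUpTo-cong b (λ {j} _ →
    trans (cong (_∸ (a + g j)) (shift c a j)) ([m+n]∸[m+o]≡n∸o a (suc (c + j)) (g j)))

encode : List Tree → ℕ → ℕ
encode []           = λ _ → 0
encode (node G ∷ F) = glue (edgesF F) (edgesF G) (encode F) (encode G)

encode⁻¹ : List Tree → ℕ → ℕ
encode⁻¹ []           = λ _ → 0
encode⁻¹ (node G ∷ F) = unglue (edgesF F) (edgesF G) (encode⁻¹ F) (encode⁻¹ G)

encode-isPermutation : ∀ F → IsPermutation (edgesF F) (encode F) (encode⁻¹ F)
encode-isPermutation [] = record
  { bounded = λ () ; inv-bounded = λ () ; left-inverse = λ () ; right-inverse = λ () }
encode-isPermutation (node G ∷ F) =
  glue-isPermutation (encode-isPermutation F) (encode-isPermutation G)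

encode-bounded : ∀ F → Bounded (encode F) (edgesF F)
encode-bounded F = IsPermutation.bounded (encode-isPermutation F)

encode-avoids : ∀ F → Avoid231 (encode F) (edgesF F)
encode-avoids []           x y z _ _ ()
encode-avoids (node G ∷ F) =
  glue-avoids (encode-bounded F) (encode-bounded G) (encode-avoids F) (encode-avoids G)

encode-injective : ∀ F F′ → edgesF F ≡ edgesF F′ → Agree (edgesF F) (encode F) (encode F′) → F ≡ F′
encode-injective []           []             _    _     = refl
encode-injective []           (_ ∷ _)        ()   _
encode-injective (_ ∷ _)      []             ()   _
encode-injective (node G ∷ F) (node G′ ∷ F′) size agree
  with glue-injective (encode-bounded F) (encode-bounded G) (encode-bounded F′) (encode-bounded G′)
                      (suc-injective size) agree
... | sameF , sameG , lower , upper =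
  cong₂ (λ X Y → node X ∷ Y) (encode-injective G G′ sameG upper) (encode-injective F F′ sameF lower)

-- Each internal node contributes exactly one descent: the one into the word of its subforest.
mutual
  encode-descents : ∀ F → desL (applyUpTo (encode F) (edgesF F)) ≡ internalsF F
  encode-descents []           = refl
  encode-descents (node G ∷ F) = begin
    desL (applyUpTo (encode (node G ∷ F)) (edgesF (node G ∷ F)))
      ≡⟨ glue-descents a (edgesF G) (encode F) (encode G) (encode-bounded F) ⟩
    desL (applyUpTo (encode F) a) + desFrom (a + edgesF G) (applyUpTo (λ j → a + encode G j) (edgesF G))
      ≡⟨ cong₂ _+_ (encode-descents F) (subtree-descents a G) ⟩
    internalsF F + internals (node G)
      ≡⟨ +-comm (internalsF F) (internals (node G)) ⟩
    internalsF (node G ∷ F) ∎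
    where a = edgesF F

  subtree-descents : ∀ a G →
    desFrom (a + edgesF G) (applyUpTo (λ j → a + encode G j) (edgesF G)) ≡ internals (node G)
  subtree-descents a []          = refl
  subtree-descents a G@(_ ∷ _) =
    trans (desFrom-block a _ (encode G) (encode-bounded G)) (cong suc (encode-descents G))

levelMax : ℕ → List Tree → ℕ
levelMax c []          = 0
levelMax c F@(_ ∷ _) = c + heightF F

levelMax-⊔ : ∀ c F x → levelMax c F ⊔ (c + x) ≡ c + (x ⊔ heightF F)
levelMax-⊔ c []          x = cong (c +_) (sym (⊔-identityʳ x))
levelMax-⊔ c F@(_ ∷ _) x =
  trans (sym (+-distribˡ-⊔ c (heightF F) x)) (cong (c +_) (⊔-comm (heightF F) x))

subtree-drop : ∀ c G → (c ∸ edgesF G) ⊔ levelMax (suc c) G ≡ c + height (node G)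
subtree-drop c []          = trans (⊔-identityʳ c) (sym (+-identityʳ c))
subtree-drop c G@(_ ∷ _) = trans
  (m≤n⇒m⊔n≡n (≤-trans (m∸n≤m c (edgesF G)) (≤-trans (m≤m+n c (heightF G)) (n≤1+n _))))
  (sym (+-suc c (heightF G)))

-- The drops of a forest's word measure depth: the largest is the height.
encode-maxDrop : ∀ c F → maxDrop c (encode F) (edgesF F) ≡ levelMax c F
encode-maxDrop c []           = refl
encode-maxDrop c (node G ∷ F) = begin
  maxDrop c (encode (node G ∷ F)) (edgesF (node G ∷ F))
    ≡⟨ glue-maxDrop c (edgesF F) (edgesF G) (encode F) (encode G) ⟩
  maxDrop c (encode F) (edgesF F) ⊔ ((c ∸ edgesF G) ⊔ maxDrop (suc c) (encode G) (edgesF G))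
    ≡⟨ cong₂ (λ x y → x ⊔ ((c ∸ edgesF G) ⊔ y)) (encode-maxDrop c F) (encode-maxDrop (suc c) G) ⟩
  levelMax c F ⊔ ((c ∸ edgesF G) ⊔ levelMax (suc c) G)
    ≡⟨ cong (levelMax c F ⊔_) (subtree-drop c G) ⟩
  levelMax c F ⊔ (c + height (node G))
    ≡⟨ levelMax-⊔ c F (height (node G)) ⟩
  c + heightF (node G ∷ F) ∎

encode-height : ∀ F → maxDrop 0 (encode F) (edgesF F) ≡ heightF F
encode-height []          = refl
encode-height F@(_ ∷ _) = encode-maxDrop 0 F

injection⇒≤ : ∀ {p q} (f : ℕ → ℕ) → (∀ {i} → i < p → f i < q) →
              (∀ {i j} → i < p → j < p → f i ≡ f j → i ≡ j) → p ≤ q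
injection⇒≤ {p} {q} f bound injective = FinProps.injective⇒≤ {f = f′} f′-injective
  where
  f′ : Fin p → Fin q
  f′ i = fromℕ< (bound (FinProps.toℕ<n i))
  f′-injective : ∀ {x y} → f′ x ≡ f′ y → x ≡ y
  f′-injective {x} {y} e = FinProps.toℕ-injective (injective (FinProps.toℕ<n x) (FinProps.toℕ<n y)
    (trans (sym (FinProps.toℕ-fromℕ< _)) (trans (cong toℕ e) (FinProps.toℕ-fromℕ< _))))

Decomposition : ℕ → (ℕ → ℕ) → Set
Decomposition n g = Σ (List Tree) λ F → edgesF F ≡ n × Agree n (encode F) g

-- A 231-avoiding permutation g of [0, 1+m) with inverse h, split at the position p of its
-- maximum m: left of p it permutes [0, p), right of p it is a permutation of [0, m-p) shifted
-- up by p; both parts avoid 231, and forests for them reassemble into a forest for g.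
module MaxSplit {m : ℕ} {g h : ℕ → ℕ} (P : IsPermutation (suc m) g h)
                (avoids : Avoid231 g (suc m)) where
  open IsPermutation P

  p : ℕ
  p = h m

  p≤m : p ≤ m
  p≤m = s≤s⁻¹ (inv-bounded (n<1+n m))

  g[p] : g p ≡ m
  g[p] = right-inverse (n<1+n m)

  <p⇒<n : ∀ {i} → i < p → i < suc m
  <p⇒<n i<p = m<n⇒m<1+n (<-≤-trans i<p p≤m)

  g-injective : ∀ {i j} → i < suc m → j < suc m → g i ≡ g j → i ≡ j
  g-injective i<n j<n e = trans (sym (left-inverse i<n)) (trans (cong h e) (left-inverse j<n))

  h-injective : ∀ {v w} → v < suc m → w < suc m → h v ≡ h w → v ≡ w
  h-injective v<n w<n e = trans (sym (right-inverse v<n)) (trans (cong g e) (right-inverse w<n))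

  position-of-max : ∀ {v} → v < suc m → h v ≡ p → v ≡ m
  position-of-max v<n e = trans (sym (right-inverse v<n)) (trans (cong g e) g[p])

  below-max : ∀ {i} → i < suc m → i ≢ p → g i < m
  below-max i<n i≢p = ≤∧≢⇒< (s≤s⁻¹ (bounded i<n)) (λ gi≡m → i≢p (trans (sym (left-inverse i<n)) (cong h gi≡m)))

  -- letters left of the maximum are smaller than letters right of it (else i, p, j is a 231)
  separated : ∀ {i j} → i < p → p < j → j < suc m → g i < g j
  separated {i} {j} i<p p<j j<n with <-cmp (g i) (g j)
  ... | tri< lt _ _ = lt
  ... | tri≈ _ e _  = contradiction (g-injective (<p⇒<n i<p) j<n e) (<⇒≢ (<-trans i<p p<j))
  ... | tri> _ _ gt =
    ⊥-elim (avoids i p j i<p p<j j<n gt (subst (g i <_) (sym g[p]) (below-max (<p⇒<n i<p) (<⇒≢ i<p))))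

  -- left of p only values below p occur: the values 0, …, g(i) all occur left of p
  left-bounded : Bounded g p
  left-bounded {i} i<p = injection⇒≤ h occurs-left (λ v≤ w≤ → h-injective (≤gi⇒<n v≤) (≤gi⇒<n w≤))
    where
    ≤gi⇒<n : ∀ {w} → w < suc (g i) → w < suc m
    ≤gi⇒<n w≤gi = ≤-<-trans (s≤s⁻¹ w≤gi) (bounded (<p⇒<n i<p))
    occurs-left : ∀ {w} → w < suc (g i) → h w < p
    occurs-left {w} w≤gi with <-cmp (h w) p
    ... | tri< lt _ _ = lt
    ... | tri≈ _ e _  = contradiction (≤-<-trans (s≤s⁻¹ w≤gi) (below-max (<p⇒<n i<p) (<⇒≢ i<p)))
                                      (<-irrefl (position-of-max (≤gi⇒<n w≤gi) e))
    ... | tri> _ _ gt = contradiction (separated i<p gt (inv-bounded (≤gi⇒<n w≤gi)))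
                          (≤⇒≯ (subst (_≤ g i) (sym (right-inverse (≤gi⇒<n w≤gi))) (s≤s⁻¹ w≤gi)))

  -- every value v < p occurs left of p: otherwise all p letters left of p would lie below v
  left-inverse-bounded : Bounded h p
  left-inverse-bounded {v} v<p with h v <? p
  ... | yes lt = lt
  ... | no hv≮p = contradiction
          (injection⇒≤ g (λ a<p → subst (g _ <_) (right-inverse v<n) (separated a<p p<hv (inv-bounded v<n)))
                         (λ a<p b<p → g-injective (<p⇒<n a<p) (<p⇒<n b<p)))
          (<⇒≱ v<p)
    where
    v<n = <p⇒<n v<p
    p<hv : p < h v
    p<hv = ≤∧≢⇒< (≮⇒≥ hv≮p) (λ p≡hv → <-irrefl (position-of-max v<n (sym p≡hv)) (<-≤-trans v<p p≤m))

  left-isPermutation : IsPermutation p g h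
  left-isPermutation = record
    { bounded       = left-bounded
    ; inv-bounded   = left-inverse-bounded
    ; left-inverse  = λ i<p → left-inverse (<p⇒<n i<p)
    ; right-inverse = λ v<p → right-inverse (<p⇒<n v<p)
    }

  left-avoids : Avoid231 g p
  left-avoids x y z x<y y<z z<p = avoids x y z x<y y<z (<p⇒<n z<p)

  r : ℕ
  r = m ∸ p

  g′ h′ : ℕ → ℕ
  g′ j = g (suc (p + j)) ∸ p
  h′ w = h (p + w) ∸ suc p

  shifted< : ∀ {j} → j < r → p + j < m
  shifted< j<r = subst (p + _ <_) (m+[n∸m]≡n p≤m) (+-monoʳ-< p j<r)

  right<n : ∀ {j} → j < r → suc (p + j) < suc m
  right<n j<r = s≤s (shifted< j<r)

  -- right of the maximum, the values lie in [p, m) (since all values below p occur left of p) ...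
  right-≥ : ∀ {j} → j < r → p ≤ g (suc (p + j))
  right-≥ {j} j<r with g (suc (p + j)) <? p
  ... | no ≮     = ≮⇒≥ ≮
  ... | yes gj<p = contradiction (subst (_< p) (left-inverse (right<n j<r)) (left-inverse-bounded gj<p))
                                 (<⇒≯ (s≤s (m≤m+n p j)))

  right-< : ∀ {j} → j < r → g (suc (p + j)) < m
  right-< {j} j<r = below-max (right<n j<r) (m≢1+m+n p ∘ sym)

  right-inverse-> : ∀ {w} → w < r → p < h (p + w)
  right-inverse-> {w} w<r with <-cmp (h (p + w)) p
  ... | tri> _ _ gt = gt
  ... | tri≈ _ e _  = contradiction (shifted< w<r) (<-irrefl (position-of-max pw<n e))
    where pw<n = m<n⇒m<1+n (shifted< w<r)
  ... | tri< lt _ _ = contradiction (subst (_< p) (right-inverse pw<n) (left-bounded lt)) (m+n≮m p w)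
    where pw<n = m<n⇒m<1+n (shifted< w<r)

  right-isPermutation : IsPermutation r g′ h′
  right-isPermutation = record
    { bounded       = λ j<r → ∸-monoˡ-< (right-< j<r) (right-≥ j<r)
    ; inv-bounded   = λ w<r → ∸-monoˡ-< (inv-bounded (m<n⇒m<1+n (shifted< w<r))) (right-inverse-> w<r)
    ; left-inverse  = λ {j} j<r → begin
        h (p + (g (suc (p + j)) ∸ p)) ∸ suc p ≡⟨ cong (λ v → h v ∸ suc p) (m+[n∸m]≡n (right-≥ j<r)) ⟩
        h (g (suc (p + j))) ∸ suc p           ≡⟨ cong (_∸ suc p) (left-inverse (right<n j<r)) ⟩
        suc (p + j) ∸ suc p                   ≡⟨ m+n∸m≡n (suc p) j ⟩
        j                                     ∎
    ; right-inverse = λ {w} w<r → begin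
        g (suc (p + (h (p + w) ∸ suc p))) ∸ p ≡⟨ cong (λ i → g i ∸ p) (m+[n∸m]≡n (right-inverse-> w<r)) ⟩
        g (h (p + w)) ∸ p                     ≡⟨ cong (_∸ p) (right-inverse (m<n⇒m<1+n (shifted< w<r))) ⟩
        p + w ∸ p                             ≡⟨ m+n∸m≡n p w ⟩
        w                                     ∎
    }

  right-avoids : Avoid231 g′ r
  right-avoids x y z x<y y<z z<r gz<gx gx<gy =
    avoids (suc (p + x)) (suc (p + y)) (suc (p + z)) (s≤s (+-monoʳ-< p x<y)) (s≤s (+-monoʳ-< p y<z))
           (right<n z<r) (unshift z<r x<r gz<gx) (unshift x<r y<r gx<gy)
    where
    y<r = <-trans y<z z<r
    x<r = <-trans x<y y<r
    unshift : ∀ {i j} → i < r → j < r → g′ i < g′ j → g (suc (p + i)) < g (suc (p + j))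
    unshift i<r j<r lt = subst₂ _<_ (m+[n∸m]≡n (right-≥ i<r)) (m+[n∸m]≡n (right-≥ j<r)) (+-monoʳ-< p lt)

  assemble : Decomposition p g → Decomposition r g′ → Decomposition (suc m) g
  assemble (L , eL , agreeL) (R , eR , agreeR) = node R ∷ L , size , agree
    where
    size : suc (edgesF R + edgesF L) ≡ suc m
    size = cong suc (trans (cong₂ _+_ eR eL) (m∸n+n≡m p≤m))
    lower : Agree (edgesF L) g (encode L)
    lower i<a = sym (agreeL (subst (_ <_) eL i<a))
    middle : g (edgesF L) ≡ edgesF L + edgesF R
    middle rewrite eL | eR = trans g[p] (sym (m+[n∸m]≡n p≤m))
    upper : ∀ {j} → j < edgesF R → g (suc (edgesF L + j)) ≡ edgesF L + encode R j
    upper {j} j<b rewrite eL = let j<r = subst (j <_) eR j<b in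
      trans (sym (m+[n∸m]≡n (right-≥ j<r))) (cong (p +_) (sym (agreeR j<r)))
    agree : Agree (suc m) (encode (node R ∷ L)) g
    agree {i} i<n = glue-characterisation g lower middle upper (subst (i <_) (sym size) i<n)

decompose : ∀ n {g h} → IsPermutation n g h → Avoid231 g n → Decomposition n g
decompose = <-rec Motive step
  where
  Motive : ℕ → Set
  Motive n = ∀ {g h} → IsPermutation n g h → Avoid231 g n → Decomposition n g
  step : ∀ n → (∀ {k} → k < n → Motive k) → Motive n
  step zero    _   _ _       = [] , refl , λ ()
  step (suc m) rec P avoids  = assemble
    (rec (s≤s p≤m) left-isPermutation left-avoids)
    (rec (s≤s (m∸n≤m m p)) right-isPermutation right-avoids)
    where open MaxSplit P avoids

record Represents {n} (σ : Permutation′ n) (g : ℕ → ℕ) : Set where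
  constructor mk-represents
  field value : ∀ (i : Fin n) → toℕ (σ ⟨$⟩ʳ i) ≡ g (toℕ i)
open Represents

restrict : ∀ {n} (f : ℕ → ℕ) → Bounded f n → Fin n → Fin n
restrict f bounded i = fromℕ< (bounded (FinProps.toℕ<n i))

extend : ∀ {n} → (Fin n → Fin n) → ℕ → ℕ
extend {n} f x with x <? n
... | yes x<n = toℕ (f (fromℕ< x<n))
... | no _    = 0

extend-< : ∀ {n} (f : Fin n → Fin n) {x} (x<n : x < n) → extend f x ≡ toℕ (f (fromℕ< x<n))
extend-< {n} f {x} x<n with x <? n
... | yes x<n′ = cong (λ p → toℕ (f (fromℕ< p))) (<-irrelevant x<n′ x<n)
... | no x≮n   = contradiction x<n x≮n

extend-toℕ : ∀ {n} (f : Fin n → Fin n) i → extend f (toℕ i) ≡ toℕ (f i)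
extend-toℕ f i = trans (extend-< f (FinProps.toℕ<n i)) (cong (toℕ ∘ f) (FinProps.fromℕ<-toℕ i (FinProps.toℕ<n i)))

toPermutation : ∀ {n g h} → IsPermutation n g h → Permutation′ n
toPermutation {g = g} {h} P = permutation (restrict g bounded) (restrict h inv-bounded)
  (λ v → FinProps.toℕ-injective (trans (FinProps.toℕ-fromℕ< _)
           (trans (cong g (FinProps.toℕ-fromℕ< _)) (right-inverse (FinProps.toℕ<n v)))))
  (λ i → FinProps.toℕ-injective (trans (FinProps.toℕ-fromℕ< _)
           (trans (cong h (FinProps.toℕ-fromℕ< _)) (left-inverse (FinProps.toℕ<n i)))))
  where open IsPermutation P

toPermutation-represents : ∀ {n g h} (P : IsPermutation n g h) → Represents (toPermutation P) g
toPermutation-represents P = mk-represents λ i → FinProps.toℕ-fromℕ< _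

extend-isPermutation : ∀ {n} (σ : Permutation′ n) → IsPermutation n (extend (σ ⟨$⟩ʳ_)) (extend (σ ⟨$⟩ˡ_))
extend-isPermutation σ = record
  { bounded       = λ x<n → subst (_< _) (sym (extend-< _ x<n)) (FinProps.toℕ<n _)
  ; inv-bounded   = λ x<n → subst (_< _) (sym (extend-< _ x<n)) (FinProps.toℕ<n _)
  ; left-inverse  = λ x<n → trans (cong (extend (σ ⟨$⟩ˡ_)) (extend-< _ x<n))
      (trans (extend-toℕ _ _) (trans (cong toℕ (inverseˡ σ)) (FinProps.toℕ-fromℕ< x<n)))
  ; right-inverse = λ x<n → trans (cong (extend (σ ⟨$⟩ʳ_)) (extend-< _ x<n))
      (trans (extend-toℕ _ _) (trans (cong toℕ (inverseʳ σ)) (FinProps.toℕ-fromℕ< x<n)))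
  }

extend-represents : ∀ {n} (σ : Permutation′ n) → Represents σ (extend (σ ⟨$⟩ʳ_))
extend-represents σ = mk-represents λ i → sym (extend-toℕ _ i)

module _ {n : ℕ} {σ : Permutation′ n} {g : ℕ → ℕ} (rep : Represents σ g) where
  represents-at : ∀ {x} (x<n : x < n) → g x ≡ toℕ (σ ⟨$⟩ʳ fromℕ< x<n)
  represents-at x<n = trans (cong g (sym (FinProps.toℕ-fromℕ< x<n))) (sym (value rep _))

  represents-avoids : Avoid231 g n → Avoids231 σ
  represents-avoids avoids (a , b , c , a<b , b<c , σc<σa , σa<σb) =
    avoids (toℕ a) (toℕ b) (toℕ c) a<b b<c (FinProps.toℕ<n c)
      (subst₂ _<_ (value rep c) (value rep a) σc<σa) (subst₂ _<_ (value rep a) (value rep b) σa<σb)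

  represents-avoids⁻¹ : Avoids231 σ → Avoid231 g n
  represents-avoids⁻¹ avoids x y z x<y y<z z<n gz<gx gx<gy = avoids
    ( fromℕ< x<n , fromℕ< y<n , fromℕ< z<n
    , subst₂ _<_ (sym (FinProps.toℕ-fromℕ< x<n)) (sym (FinProps.toℕ-fromℕ< y<n)) x<y
    , subst₂ _<_ (sym (FinProps.toℕ-fromℕ< y<n)) (sym (FinProps.toℕ-fromℕ< z<n)) y<z
    , subst₂ _<_ (represents-at z<n) (represents-at x<n) gz<gx
    , subst₂ _<_ (represents-at x<n) (represents-at y<n) gx<gy )
    where
    y<n = <-trans y<z z<n
    x<n = <-trans x<y y<n

  represents-word : word σ ≡ applyUpTo g n
  represents-word = trans (map-tabulate (λ i → i) _) (tabulate-applyUpTo n (value rep))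

  represents-maxdrop : maxdrop σ ≡ maxDrop 0 g n
  represents-maxdrop = cong maxL (trans (map-tabulate (λ i → i) _)
    (tabulate-applyUpTo n (λ i → cong (toℕ i ∸_) (value rep i))))

encode-isPermutation-at : ∀ F {n} → edgesF F ≡ n → IsPermutation n (encode F) (encode⁻¹ F)
encode-isPermutation-at F e = subst (λ n → IsPermutation n (encode F) (encode⁻¹ F)) e (encode-isPermutation F)

treePermutation : ∀ F {n} → edgesF F ≡ n → Permutation′ n
treePermutation F e = toPermutation (encode-isPermutation-at F e)

treePermutation-represents : ∀ F {n} (e : edgesF F ≡ n) → Represents (treePermutation F e) (encode F)
treePermutation-represents F e = toPermutation-represents (encode-isPermutation-at F e)

module _ (F : List Tree) {n : ℕ} (e : edgesF F ≡ n) {σ : Permutation′ n} (rep : Represents σ (encode F)) where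
  forest-des : des σ ≡ internalsF F
  forest-des = trans (cong desL (represents-word rep))
    (subst (λ m → desL (applyUpTo (encode F) m) ≡ internalsF F) e (encode-descents F))

  forest-maxdrop : maxdrop σ ≡ heightF F
  forest-maxdrop = trans (represents-maxdrop rep)
    (subst (λ m → maxDrop 0 (encode F) m ≡ heightF F) e (encode-height F))

internals-root : ∀ F → internals (node F) ∸ 1 ≡ internalsF F
internals-root []      = refl
internals-root (_ ∷ _) = refl

height-root : ∀ F → height (node F) ∸ 1 ≡ heightF F
height-root []      = refl
height-root (_ ∷ _) = refl

module _ {n j k : ℕ} where
  toPerm : TreeSet n j k → PermSet n (j ∸ 1) (k ∸ 1)
  toPerm (node F , e , internals≡j , height≤k) =
      treePermutation F e
    , represents-avoids rep (subst (Avoid231 (encode F)) e (encode-avoids F))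
    , trans (forest-des F e rep) (trans (sym (internals-root F)) (cong (_∸ 1) internals≡j))
    , subst (_≤ k ∸ 1) (sym (trans (forest-maxdrop F e rep) (sym (height-root F)))) (∸-monoˡ-≤ 1 height≤k)
    where rep = treePermutation-represents F e

  toPerm-respects : ∀ x y → x ≈T y → toPerm x ≈P toPerm y
  toPerm-respects (node F , e , _) (node _ , e′ , _) refl i = FinProps.toℕ-injective
    (trans (value (treePermutation-represents F e) i) (sym (value (treePermutation-represents F e′) i)))

  toPerm-injective : ∀ x y → toPerm x ≈P toPerm y → x ≈T y
  toPerm-injective (node F , e , _) (node F′ , e′ , _) σ≈τ =
    cong node (encode-injective F F′ (trans e (sym e′)) (λ {i} i<F → agree (subst (i <_) e i<F)))
    where
    agree : Agree n (encode F) (encode F′)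
    agree x<n = trans (represents-at (treePermutation-represents F e) x<n)
      (trans (cong toℕ (σ≈τ _)) (sym (represents-at (treePermutation-represents F′ e′) x<n)))

  -- decompose σ into a forest, which is nonempty as n ≥ 1
  toPerm-surjective : n ≥ 1 → j ≥ 1 → k ≥ 1 → ∀ y → Σ (TreeSet n j k) λ x → toPerm x ≈P y
  toPerm-surjective n≥1 j≥1 k≥1 (σ , avoids , des≡ , maxdrop≤) with
    decompose n (extend-isPermutation σ) (represents-avoids⁻¹ (extend-represents σ) avoids)
  ... | [] , e , _ = contradiction (trans e (sym (m+[n∸m]≡n n≥1))) λ ()
  ... | F@(_ ∷ _) , e , agree = (node F , e , internals≡j , height≤k) , same
    where
    rep : Represents σ (encode F)
    rep = mk-represents λ i → trans (value (extend-represents σ) i) (sym (agree (FinProps.toℕ<n i)))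
    internals≡j : suc (internalsF F) ≡ j
    internals≡j = trans (cong suc (trans (sym (forest-des F e rep)) des≡)) (m+[n∸m]≡n j≥1)
    height≤k : suc (heightF F) ≤ k
    height≤k = subst (suc (heightF F) ≤_) (m+[n∸m]≡n k≥1)
      (s≤s (subst (_≤ k ∸ 1) (forest-maxdrop F e rep) maxdrop≤))
    same : toPerm (node F , e , internals≡j , height≤k) ≈P (σ , avoids , des≡ , maxdrop≤)
    same i = FinProps.toℕ-injective (trans (value (treePermutation-represents F e) i) (sym (value rep i)))

toPerm-isBijection : ∀ {n j k} → n ≥ 1 → j ≥ 1 → k ≥ 1 →
                     IsBijection (_≈T_ {n} {j} {k}) (_≈P_ {n} {j ∸ 1} {k ∸ 1}) toPerm
toPerm-isBijection n≥1 j≥1 k≥1 = toPerm-respects , toPerm-injective , toPerm-surjective n≥1 j≥1 k≥1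

bijection-card : ∀ {A B : Set} {_≈A_ : A → A → Set} {_≈B_ : B → B → Set} → IsEquivalence _≈B_ →
                 (f : A → B) → IsBijection _≈A_ _≈B_ f → ∀ c → HasCard _≈A_ c ⇔ HasCard _≈B_ c
bijection-card {A} {B} {_≈A_} {_≈B_} ≈B-equivalence f (respects , injective , surjective) c =
  mk⇔ forward backward
  where
  open IsEquivalence ≈B-equivalence renaming (sym to ≈B-sym; trans to ≈B-trans)
  f⁻¹ : B → A
  f⁻¹ y = proj₁ (surjective y)
  f∘f⁻¹ : ∀ y → f (f⁻¹ y) ≈B y
  f∘f⁻¹ y = proj₂ (surjective y)

  forward : HasCard _≈A_ c → HasCard _≈B_ c
  forward (count , count-respects , count-injective , count-surjective) =
      (λ y → count (f⁻¹ y))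
    , (λ y y′ y≈y′ → count-respects _ _ (injective _ _ (≈B-trans (f∘f⁻¹ y) (≈B-trans y≈y′ (≈B-sym (f∘f⁻¹ y′))))))
    , (λ y y′ e → ≈B-trans (≈B-sym (f∘f⁻¹ y)) (≈B-trans (respects _ _ (count-injective _ _ e)) (f∘f⁻¹ y′)))
    , (λ i → let x , count-x≡i = count-surjective i in
             f x , trans (count-respects _ _ (injective _ _ (f∘f⁻¹ (f x)))) count-x≡i)

  backward : HasCard _≈B_ c → HasCard _≈A_ c
  backward (count , count-respects , count-injective , count-surjective) =
      (λ x → count (f x))
    , (λ x x′ x≈x′ → count-respects _ _ (respects x x′ x≈x′))
    , (λ x x′ e → injective x x′ (count-injective _ _ e))
    , (λ i → let y , count-y≡i = count-surjective i ; x , fx≈y = surjective y in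
             x , trans (count-respects _ _ fx≈y) count-y≡i)

≈P-isEquivalence : ∀ {n d m} → IsEquivalence (_≈P_ {n} {d} {m})
≈P-isEquivalence = record
  { refl  = λ _ → refl
  ; sym   = λ σ≈τ i → sym (σ≈τ i)
  ; trans = λ σ≈τ τ≈ρ i → trans (σ≈τ i) (τ≈ρ i)
  }

theorem6 :
  ((n k j : ℕ) → n ≥ 1 → k ≥ 1 → j ≥ 1 →
    Σ (TreeSet n j k → PermSet n (j ∸ 1) (k ∸ 1)) λ f →
      IsBijection (_≈T_ {n} {j} {k}) (_≈P_ {n} {j ∸ 1} {k ∸ 1}) f)
  ×
  ((n j k : ℕ) → n ≥ 1 → (c : ℕ) →
    HasCard (_≈P_ {n} {j} {k}) c ⇔ HasCard (_≈T_ {n} {suc j} {suc k}) c)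
theorem6 =
    (λ n k j n≥1 k≥1 j≥1 → toPerm , toPerm-isBijection n≥1 j≥1 k≥1)
  , (λ n j k n≥1 c → ⇔.sym (bijection-card ≈P-isEquivalence toPerm
                             (toPerm-isBijection n≥1 (s≤s z≤n) (s≤s z≤n)) c))
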